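{- Let $n$ be a positive odd integer. Let $U_1$ be the number of ordered pairs $(s_1,s_2)$ of squares of integers with $n=s_1+2s_2$, and $V_1$ the number of ordered pairs $(s_1,s_2)$ of squares of integers with $n=s_1+4s_2$. Then the number $U$ of ideals of norm $n$ in $\mathbb{Z}[\sqrt{ -2}]$ is $2U_1-1$ when $n$ is a square and $2U_1$ otherwise; and the number $V$ of ideals of norm $n$ in $\mathbb{Z}[i]$ is $2V_1-1$ when $n$ is a square and $2V_1$ otherwise.
   Context: An ideal of norm $n$ in a ring $R$ is a nonzero ideal $I$ with $|R/I|=n$. "Squares of integers" means elements of $\{0,1,4,9,\dots\}$; pairs are counted as pairs of these square values. -}

module Defs where

open import Data.Nat as ℕ using (ℕ; suc; _%_)
open import Data.Integer as ℤ using (ℤ; +_)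
open import Data.Fin using (Fin)
open import Data.Product using (Σ; ∃; _×_; _,_)
open import Data.List using (List; length; filter; upTo; cartesianProduct)
open import Relation.Nullary using (¬_)
open import Relation.Binary.PropositionalEquality using (_≡_; _≢_)
open import Level using (suc; zero)

-- The ring ℤ[√-d] : element (a , b) stands for a + b √-d.

ℤ[√-_] : ℕ → Set
ℤ[√- d ] = ℤ × ℤ

module Ring (d : ℕ) where
  0R : ℤ[√- d ]
  0R = (+ 0 , + 0)

  _+R_ : ℤ[√- d ] → ℤ[√- d ] → ℤ[√- d ]
  (a , b) +R (c , e) = (a ℤ.+ c , b ℤ.+ e)

  -R_ : ℤ[√- d ] → ℤ[√- d ]
  -R (a , b) = (ℤ.- a , ℤ.- b)

  _-R_ : ℤ[√- d ] → ℤ[√- d ] → ℤ[√- d ]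
  x -R y = x +R (-R y)

  _*R_ : ℤ[√- d ] → ℤ[√- d ] → ℤ[√- d ]
  (a , b) *R (c , e) = (a ℤ.* c ℤ.- (+ d) ℤ.* (b ℤ.* e) , a ℤ.* e ℤ.+ b ℤ.* c)

  record Ideal : Set₁ where
    field
      Mem  : ℤ[√- d ] → Set
      0∈   : Mem 0R
      +∈   : ∀ {x y} → Mem x → Mem y → Mem (x +R y)
      *∈   : ∀ r {x} → Mem x → Mem (r *R x)
  open Ideal public

  NonzeroIdeal : Ideal → Set
  NonzeroIdeal I = ∃ λ x → x ≢ 0R × Mem I x

  -- |R / I| = n : a surjection f : R → Fin n whose fibres are exactly
  -- the cosets of I (i.e. an explicit bijection R/I ≃ Fin n).
  QuotientCard : Ideal → ℕ → Set
  QuotientCard I n =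
    Σ (ℤ[√- d ] → Fin n) λ f →
      (∀ k → ∃ λ x → f x ≡ k) ×
      (∀ x y → (f x ≡ f y → Mem I (x -R y)) × (Mem I (x -R y) → f x ≡ f y))

  HasNorm : Ideal → ℕ → Set
  HasNorm I n = NonzeroIdeal I × QuotientCard I n

  SameIdeal : Ideal → Ideal → Set
  SameIdeal I J = ∀ x → (Mem I x → Mem J x) × (Mem J x → Mem I x)

  NumIdealsOfNorm : ℕ → ℕ → Set₁
  NumIdealsOfNorm n U =
    Σ (Fin U → Ideal) λ e →
      (∀ k → HasNorm (e k) n) ×
      (∀ k l → SameIdeal (e k) (e l) → k ≡ l) ×
      (∀ I → HasNorm I n → ∃ λ k → SameIdeal I (e k))

IsSquare : ℕ → Set
IsSquare n = ∃ λ k → k ℕ.* k ≡ n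

-- Square values s correspond bijectively to their roots x ∈ ℕ (s = x²),
-- and all roots are ≤ n, so we count pairs (x , y) ∈ [0,n]² with
-- n = x² + c y².
squarePairCount : ℕ → ℕ → ℕ
squarePairCount c n =
  length (filter (λ p → (Data.Product.proj₁ p ℕ.* Data.Product.proj₁ p
                         ℕ.+ c ℕ.* (Data.Product.proj₂ p ℕ.* Data.Product.proj₂ p)) ℕ.≟ n)
                 (cartesianProduct (upTo (ℕ.suc n)) (upTo (ℕ.suc n))))

U₁ : ℕ → ℕ
U₁ = squarePairCount 2

V₁ : ℕ → ℕ
V₁ = squarePairCount 4

module Submission where

-- Both rings are norm-Euclidean, so every ideal of norm n is ⟨γ⟩ with N(γ) = n:
-- a nonzero element γ of least norm in I generates I, since rounding x·conj γ / N(γ)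
-- leaves a remainder of norm ≤ 3/4 · N(γ).  Conversely |ℤ[√-d] / ⟨γ⟩| = N(γ), shown by
-- putting ⟨γ⟩ in Hermite normal form (basis (g , t), (0 , h); the residues
-- [0,g) × [0,h) form the quotient) and comparing determinants, which gives g·h = N(γ).
-- Since n is odd, each such γ has exactly one unit multiple (+x , ±k·y) with
-- x² + c·y² = n (k = 1, c = 2 for ℤ[√-2]; k = 2, c = 4 for ℤ[i]).  Listing these
-- generators enumerates the ideals of norm n, and the list has length 2·U₁ − 1 or
-- 2·U₁ (resp. V₁) according as n is a square, since only y = 0 yields one generator.
module ImaginaryQuadratic where
  open import Defs
  open import Data.Nat as ℕ using (ℕ; zero; suc; _<_; _≤_; z≤n; s≤s)
  import Data.Nat.Properties as ℕP
  import Data.Nat.Divisibility as ℕ∣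
  import Data.Nat.Tactic.RingSolver as ℕSolver
  open import Data.Nat.Induction using (<-rec)
  open import Data.Nat.DivMod using (_%_; _/_; m≡m%n+[m/n]*n; %-distribˡ-+; %-distribˡ-*; m*n%n≡0; m%n<n)
  open import Data.Integer using (ℤ; +_; -[1+_]; ∣_∣; _+_; _*_; -_; _-_)
  import Data.Integer.Properties as ℤP
  open import Data.Integer.DivMod using (_/ℕ_; _%ℕ_; a≡a%ℕn+[a/ℕn]*n; n%ℕd<d)
  open import Data.Integer.Divisibility.Signed using (_∣_; divides; _∣?_; ∣⇒∣ᵤ)
  open import Data.Integer.Tactic.RingSolver using (solve-∀)
  open import Data.Fin as Fin using (Fin; toℕ; fromℕ<; combine)
  import Data.Fin.Properties as FinP
  open import Data.Product using (Σ; _×_; _,_; proj₁; proj₂)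
  open import Data.Sum using (_⊎_; inj₁; inj₂)
  open import Data.List using (List; []; _∷_; length; filter; upTo; cartesianProduct; concatMap; lookup)
  open import Data.List.Membership.Propositional using (_∈_; _∉_; find)
  import Data.List.Membership.Propositional.Properties as ∈P
  open import Data.List.Relation.Unary.Any using (here; there)
  import Data.List.Relation.Unary.Any as Any
  import Data.List.Relation.Unary.Any.Properties as AnyP
  import Data.List.Relation.Unary.All as All
  open import Data.List.Relation.Unary.All using ([]; _∷_)
  open import Data.List.Relation.Unary.AllPairs using ([]; _∷_)
  open import Data.List.Relation.Unary.Unique.Propositional using (Unique)
  import Data.List.Relation.Unary.Unique.Propositional.Properties as UniqueP
  open import Data.Empty using (⊥-elim)
  open import Relation.Nullary using (¬_; Dec; yes; no)
  open import Relation.Nullary.Decidable using (_×-dec_; map′)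
  open import Relation.Binary.PropositionalEquality
  open import Relation.Binary.Definitions using (tri<; tri≈; tri>)

  Least : (ℕ → Set) → Set
  Least P = Σ ℕ λ k → P k × (∀ j → j < k → ¬ P j)

  least : ∀ {P : ℕ → Set} → (∀ n → Dec (P n)) → ∀ m → P m → Least P
  least {P} P? = <-rec (λ m → P m → Least P) step
    where
    step : ∀ m → (∀ {j} → j < m → P j → Least P) → P m → Least P
    step m smaller pm with ℕP.anyUpTo? P? m
    ... | yes (j , j<m , pj) = smaller j<m pj
    ... | no none = m , pm , λ j j<m pj → none (j , j<m , pj)

  positive-multiple-≥ : ∀ {G x y} k → + x ≡ + y + + suc k * + G → G ≤ x
  positive-multiple-≥ {G} {x} {y} k e = begin
    G                 ≤⟨ ℕP.m≤n*m G (suc k) ⟩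
    suc k ℕ.* G       ≤⟨ ℕP.m≤n+m _ y ⟩
    y ℕ.+ suc k ℕ.* G ≡⟨ ℤP.+-injective (sym as-ℕ) ⟩
    x                 ∎
    where
    open ℕP.≤-Reasoning
    as-ℕ : + x ≡ + (y ℕ.+ suc k ℕ.* G)
    as-ℕ = trans e (trans (cong (λ z → + y + z) (sym (ℤP.pos-* (suc k) G))) (sym (ℤP.pos-+ y _)))

  residue-unique : ∀ {G r r'} δ → r < G → r' < G → + r ≡ + r' + δ * + G → r ≡ r' × δ ≡ + 0
  residue-unique {G} {r} {r'} δ r<G r'<G e = r≡r' (δ≡0 δ e) , δ≡0 δ e
    where
    swap : ∀ b δ G → b ≡ (b + δ * G) + (- δ) * G
    swap = solve-∀
    δ≡0 : ∀ δ → + r ≡ + r' + δ * + G → δ ≡ + 0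
    δ≡0 (+ zero) _ = refl
    δ≡0 (+ suc k) e = ⊥-elim (ℕP.<⇒≱ r<G (positive-multiple-≥ k e))
    δ≡0 -[1+ k ] e = ⊥-elim (ℕP.<⇒≱ r'<G (positive-multiple-≥ k
      (trans (swap (+ r') -[1+ k ] (+ G)) (cong (_+ + suc k * + G) (sym e)))))
    r≡r' : δ ≡ + 0 → r ≡ r'
    r≡r' refl = ℤP.+-injective (trans e (ℤP.+-identityʳ (+ r')))

  nearest-division : ∀ c N .{{_ : ℕ.NonZero N}} →
    Σ ℤ λ q → Σ ℤ λ e → (c ≡ e + q * + N) × (2 ℕ.* ∣ e ∣ ≤ N)
  nearest-division c N with 2 ℕ.* (c %ℕ N) ℕ.≤? N
  ... | yes small = c /ℕ N , + (c %ℕ N) , a≡a%ℕn+[a/ℕn]*n c N , small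
  ... | no large = c /ℕ N + + 1 , - + s , rounded-up , bound
    where
    r = c %ℕ N
    s = N ℕ.∸ r
    r+s≡N : + r + + s ≡ + N
    r+s≡N = trans (sym (ℤP.pos-+ r s)) (cong +_ (ℕP.m+[n∸m]≡n (ℕP.<⇒≤ (n%ℕd<d c N))))
    shift : ∀ r s q → r + q * (r + s) ≡ - s + (q + + 1) * (r + s)
    shift = solve-∀
    rounded-up : c ≡ - + s + (c /ℕ N + + 1) * + N
    rounded-up = begin
      c                                  ≡⟨ a≡a%ℕn+[a/ℕn]*n c N ⟩
      + r + (c /ℕ N) * + N               ≡⟨ cong (λ z → + r + (c /ℕ N) * z) (sym r+s≡N) ⟩
      + r + (c /ℕ N) * (+ r + + s)       ≡⟨ shift (+ r) (+ s) (c /ℕ N) ⟩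
      - + s + (c /ℕ N + + 1) * (+ r + + s) ≡⟨ cong (λ z → - + s + (c /ℕ N + + 1) * z) r+s≡N ⟩
      - + s + (c /ℕ N + + 1) * + N       ∎
      where open ≡-Reasoning
    double : ∀ m → 2 ℕ.* m ≡ m ℕ.+ m
    double m = cong (m ℕ.+_) (ℕP.+-identityʳ m)
    s<r : s < r
    s<r = ℕP.+-cancelˡ-< r s r (subst (ℕ._< r ℕ.+ r) (sym (ℤP.+-injective (trans (ℤP.pos-+ r s) r+s≡N)))
            (subst (N <_) (double r) (ℕP.≰⇒> large)))
    bound : 2 ℕ.* ∣ - + s ∣ ≤ N
    bound = begin
      2 ℕ.* ∣ - + s ∣ ≡⟨ cong (2 ℕ.*_) (ℤP.∣-i∣≡∣i∣ (+ s)) ⟩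
      2 ℕ.* s        ≡⟨ double s ⟩
      s ℕ.+ s        ≤⟨ ℕP.+-monoˡ-≤ s (ℕP.<⇒≤ s<r) ⟩
      r ℕ.+ s        ≡⟨ ℤP.+-injective (trans (ℤP.pos-+ r s) r+s≡N) ⟩
      N              ∎
      where open ℕP.≤-Reasoning

  n≤n*n : ∀ n → n ≤ n ℕ.* n
  n≤n*n zero = z≤n
  n≤n*n (suc n) = ℕP.m≤m*n (suc n) (suc n)

  square-injective : ∀ x y → x ℕ.* x ≡ y ℕ.* y → x ≡ y
  square-injective x y e with ℕP.<-cmp x y
  ... | tri< x<y _ _ = ⊥-elim (ℕP.<-irrefl e (ℕP.*-mono-< x<y x<y))
  ... | tri≈ _ x≡y _ = x≡y
  ... | tri> _ _ y<x = ⊥-elim (ℕP.<-irrefl (sym e) (ℕP.*-mono-< y<x y<x))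

  parity : ∀ x → x % 2 ≡ 0 ⊎ x % 2 ≡ 1
  parity x with x % 2 | m%n<n x 2
  ... | zero | _ = inj₁ refl
  ... | suc zero | _ = inj₂ refl
  ... | suc (suc _) | s≤s (s≤s ())

  square-parity : ∀ x → (x ℕ.* x) % 2 ≡ x % 2
  square-parity x = trans (%-distribˡ-* x x 2) (bit-square (parity x))
    where
    bit-square : x % 2 ≡ 0 ⊎ x % 2 ≡ 1 → ((x % 2) ℕ.* (x % 2)) % 2 ≡ x % 2
    bit-square (inj₁ e) rewrite e = refl
    bit-square (inj₂ e) rewrite e = refl

  even≢odd : ∀ m → m % 2 ≡ 0 → m % 2 ≢ 1
  even≢odd _ even odd = ℕP.0≢1+n (trans (sym even) odd)

  square-plus-parity : ∀ x z → (x ℕ.* x ℕ.+ z) % 2 ≡ (x % 2 ℕ.+ z % 2) % 2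
  square-plus-parity x z = trans (%-distribˡ-+ (x ℕ.* x) z 2) (cong (λ w → (w ℕ.+ z % 2) % 2) (square-parity x))

  even-times : ∀ c z → c % 2 ≡ 0 → (c ℕ.* z) % 2 ≡ 0
  even-times c z e = trans (%-distribˡ-* c z 2) (cong (λ a → (a ℕ.* (z % 2)) % 2) e)

  even-half : ∀ b → b % 2 ≡ 0 → b ≡ 2 ℕ.* (b / 2)
  even-half b e = trans (m≡m%n+[m/n]*n b 2) (trans (cong (ℕ._+ (b / 2) ℕ.* 2) e) (ℕP.*-comm (b / 2) 2))

  odd≢double : ∀ x w → x % 2 ≡ 1 → x ≢ 2 ℕ.* w
  odd≢double x w odd refl = even≢odd (2 ℕ.* w) (trans (cong (_% 2) (ℕP.*-comm 2 w)) (m*n%n≡0 w 2)) odd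

  odd-square-part : ∀ x y c n → x ℕ.* x ℕ.+ c ℕ.* (y ℕ.* y) ≡ n → n % 2 ≡ 1 → c % 2 ≡ 0 → x % 2 ≡ 1
  odd-square-part x y c n e n-odd c-even with parity x
  ... | inj₂ x-odd = x-odd
  ... | inj₁ x-even = ⊥-elim (even≢odd n n-even n-odd)
    where
    n-even : n % 2 ≡ 0
    n-even = trans (cong (_% 2) (sym e)) (trans (square-plus-parity x _)
               (cong₂ (λ a b → (a ℕ.+ b) % 2) x-even (even-times c _ c-even)))

  sum-of-squares-parity : ∀ a b {n} → a ℕ.* a ℕ.+ b ℕ.* b ≡ n → n % 2 ≡ (a % 2 ℕ.+ b % 2) % 2
  sum-of-squares-parity a b refl =
    trans (square-plus-parity a (b ℕ.* b)) (cong (λ z → (a % 2 ℕ.+ z) % 2) (square-parity b))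

  odd-sum-of-squares : ∀ a b n → a ℕ.* a ℕ.+ b ℕ.* b ≡ n → n % 2 ≡ 1 →
    (a % 2 ≡ 1 × b % 2 ≡ 0) ⊎ (a % 2 ≡ 0 × b % 2 ≡ 1)
  odd-sum-of-squares a b n e n-odd with parity a | parity b
  ... | inj₂ pa | inj₁ pb = inj₁ (pa , pb)
  ... | inj₁ pa | inj₂ pb = inj₂ (pa , pb)
  ... | inj₁ pa | inj₁ pb =
    ⊥-elim (even≢odd n (trans (sum-of-squares-parity a b e) (cong₂ (λ u v → (u ℕ.+ v) % 2) pa pb)) n-odd)
  ... | inj₂ pa | inj₂ pb =
    ⊥-elim (even≢odd n (trans (sum-of-squares-parity a b e) (cong₂ (λ u v → (u ℕ.+ v) % 2) pa pb)) n-odd)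

  minus-multiple : ∀ {v r} q G → v ≡ r + q * G → v - q * G ≡ r
  minus-multiple {r = r} q G refl = cancel r q G
    where
    cancel : ∀ r q G → (r + q * G) - q * G ≡ r
    cancel = solve-∀

  from-difference : ∀ {x y z} → x - y ≡ z → x ≡ y + z
  from-difference {x} {y} refl = restore x y
    where
    restore : ∀ x y → x ≡ y + (x - y)
    restore = solve-∀

  square≡0 : ∀ m → m ℕ.* m ≡ 0 → m ≡ 0
  square≡0 zero _ = refl

  sq-abs : ∀ a → + (∣ a ∣ ℕ.* ∣ a ∣) ≡ a * a
  sq-abs (+ n) = ℤP.pos-* n n
  sq-abs -[1+ n ] = refl

  module Arithmetic (d : ℕ) where
    open Ring d public

    infixr 7 _·_
    _·_ : ℤ → ℤ[√- d ] → ℤ[√- d ]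
    k · (x , y) = (k * x , k * y)

    conj : ℤ[√- d ] → ℤ[√- d ]
    conj (a , b) = (a , - b)

    normℤ : ℤ[√- d ] → ℤ
    normℤ (a , b) = a * a + + d * (b * b)

    norm : ℤ[√- d ] → ℕ
    norm (a , b) = ∣ a ∣ ℕ.* ∣ a ∣ ℕ.+ d ℕ.* (∣ b ∣ ℕ.* ∣ b ∣)

    norm-normℤ : ∀ α → + norm α ≡ normℤ α
    norm-normℤ (a , b) = trans (ℤP.pos-+ (∣ a ∣ ℕ.* ∣ a ∣) _)
      (cong₂ _+_ (sq-abs a) (trans (ℤP.pos-* d _) (cong (λ z → + d * z) (sq-abs b))))

    scalar-*R : ∀ k α → (k , + 0) *R α ≡ k · α
    scalar-*R k (a , b) = cong₂ _,_ (re (+ d) k a b) (im k a b)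
      where
      re : ∀ D k a b → k * a - D * (+ 0 * b) ≡ k * a
      re = solve-∀
      im : ∀ k a b → k * b + + 0 * a ≡ k * b
      im = solve-∀

    *R-identityˡ : ∀ α → (+ 1 , + 0) *R α ≡ α
    *R-identityˡ α@(a , b) = trans (scalar-*R (+ 1) α) (cong₂ _,_ (ℤP.*-identityˡ a) (ℤP.*-identityˡ b))

    *R-zeroˡ : ∀ α → 0R *R α ≡ 0R
    *R-zeroˡ (a , b) = scalar-*R (+ 0) (a , b)

    *R-distribʳ-+R : ∀ x y α → (x +R y) *R α ≡ (x *R α) +R (y *R α)
    *R-distribʳ-+R (x₁ , x₂) (y₁ , y₂) (a , b) = cong₂ _,_ (re (+ d) x₁ x₂ y₁ y₂ a b) (im x₁ x₂ y₁ y₂ a b)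
      where
      re : ∀ D x₁ x₂ y₁ y₂ a b →
        (x₁ + y₁) * a - D * ((x₂ + y₂) * b) ≡ (x₁ * a - D * (x₂ * b)) + (y₁ * a - D * (y₂ * b))
      re = solve-∀
      im : ∀ x₁ x₂ y₁ y₂ a b → (x₁ + y₁) * b + (x₂ + y₂) * a ≡ (x₁ * b + x₂ * a) + (y₁ * b + y₂ * a)
      im = solve-∀

    *R-distribʳ--R : ∀ x y α → (x -R y) *R α ≡ (x *R α) -R (y *R α)
    *R-distribʳ--R (x₁ , x₂) (y₁ , y₂) (a , b) = cong₂ _,_ (re (+ d) x₁ x₂ y₁ y₂ a b) (im x₁ x₂ y₁ y₂ a b)
      where
      re : ∀ D x₁ x₂ y₁ y₂ a b →
        (x₁ - y₁) * a - D * ((x₂ - y₂) * b) ≡ (x₁ * a - D * (x₂ * b)) - (y₁ * a - D * (y₂ * b))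
      re = solve-∀
      im : ∀ x₁ x₂ y₁ y₂ a b → (x₁ - y₁) * b + (x₂ - y₂) * a ≡ (x₁ * b + x₂ * a) - (y₁ * b + y₂ * a)
      im = solve-∀

    *R-assoc : ∀ r q α → (r *R q) *R α ≡ r *R (q *R α)
    *R-assoc (r₁ , r₂) (q₁ , q₂) (a , b) = cong₂ _,_ (re (+ d) r₁ r₂ q₁ q₂ a b) (im (+ d) r₁ r₂ q₁ q₂ a b)
      where
      re : ∀ D r₁ r₂ q₁ q₂ a b → (r₁ * q₁ - D * (r₂ * q₂)) * a - D * ((r₁ * q₂ + r₂ * q₁) * b)
                              ≡ r₁ * (q₁ * a - D * (q₂ * b)) - D * (r₂ * (q₁ * b + q₂ * a))
      re = solve-∀
      im : ∀ D r₁ r₂ q₁ q₂ a b → (r₁ * q₁ - D * (r₂ * q₂)) * b + (r₁ * q₂ + r₂ * q₁) * a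
                              ≡ r₁ * (q₁ * b + q₂ * a) + r₂ * (q₁ * a - D * (q₂ * b))
      im = solve-∀

    ·-*R : ∀ k q α → (k · q) *R α ≡ k · (q *R α)
    ·-*R k (q₁ , q₂) (a , b) = cong₂ _,_ (re (+ d) k q₁ q₂ a b) (im k q₁ q₂ a b)
      where
      re : ∀ D k q₁ q₂ a b → (k * q₁) * a - D * ((k * q₂) * b) ≡ k * (q₁ * a - D * (q₂ * b))
      re = solve-∀
      im : ∀ k q₁ q₂ a b → (k * q₁) * b + (k * q₂) * a ≡ k * (q₁ * b + q₂ * a)
      im = solve-∀

    conj-cancelʳ : ∀ x α → (x *R conj α) *R α ≡ normℤ α · x
    conj-cancelʳ (x₁ , x₂) (a , b) = cong₂ _,_ (re (+ d) x₁ x₂ a b) (im (+ d) x₁ x₂ a b)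
      where
      re : ∀ D x₁ x₂ a b → (x₁ * a - D * (x₂ * - b)) * a - D * ((x₁ * - b + x₂ * a) * b)
                         ≡ (a * a + D * (b * b)) * x₁
      re = solve-∀
      im : ∀ D x₁ x₂ a b → (x₁ * a - D * (x₂ * - b)) * b + (x₁ * - b + x₂ * a) * a
                         ≡ (a * a + D * (b * b)) * x₂
      im = solve-∀

    conj-cancelˡ : ∀ q α → (q *R α) *R conj α ≡ normℤ α · q
    conj-cancelˡ (q₁ , q₂) (a , b) = cong₂ _,_ (re (+ d) q₁ q₂ a b) (im (+ d) q₁ q₂ a b)
      where
      re : ∀ D q₁ q₂ a b → (q₁ * a - D * (q₂ * b)) * a - D * ((q₁ * b + q₂ * a) * - b)
                         ≡ (a * a + D * (b * b)) * q₁
      re = solve-∀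
      im : ∀ D q₁ q₂ a b → (q₁ * a - D * (q₂ * b)) * - b + (q₁ * b + q₂ * a) * a
                         ≡ (a * a + D * (b * b)) * q₂
      im = solve-∀

    normℤ-*R : ∀ u v → normℤ (u *R v) ≡ normℤ u * normℤ v
    normℤ-*R (a , b) (c , e) = mult (+ d) a b c e
      where
      mult : ∀ D a b c e → (a * c - D * (b * e)) * (a * c - D * (b * e)) + D * ((a * e + b * c) * (a * e + b * c))
                         ≡ (a * a + D * (b * b)) * (c * c + D * (e * e))
      mult = solve-∀

    norm-*R : ∀ u v → norm (u *R v) ≡ norm u ℕ.* norm v
    norm-*R u v = ℤP.+-injective (begin
      + norm (u *R v)      ≡⟨ norm-normℤ (u *R v) ⟩
      normℤ (u *R v)       ≡⟨ normℤ-*R u v ⟩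
      normℤ u * normℤ v    ≡⟨ cong₂ _*_ (norm-normℤ u) (norm-normℤ v) ⟨
      + norm u * + norm v  ≡⟨ ℤP.pos-* (norm u) (norm v) ⟨
      + (norm u ℕ.* norm v) ∎)
      where open ≡-Reasoning

    det : ℤ[√- d ] → ℤ[√- d ] → ℤ
    det (x₁ , x₂) (y₁ , y₂) = x₁ * y₂ - x₂ * y₁

    det-*R : ∀ q q' α → det (q *R α) (q' *R α) ≡ det q q' * normℤ α
    det-*R (q₁ , q₂) (p₁ , p₂) (a , b) = scale (+ d) q₁ q₂ p₁ p₂ a b
      where
      scale : ∀ D q₁ q₂ p₁ p₂ a b →
        (q₁ * a - D * (q₂ * b)) * (p₁ * b + p₂ * a) - (q₁ * b + q₂ * a) * (p₁ * a - D * (p₂ * b))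
        ≡ (q₁ * p₂ - q₂ * p₁) * (a * a + D * (b * b))
      scale = solve-∀

    det-combination : ∀ i₁ j₁ i₂ j₂ u v →
      det ((i₁ · u) +R (j₁ · v)) ((i₂ · u) +R (j₂ · v)) ≡ (i₁ * j₂ - j₁ * i₂) * det u v
    det-combination i₁ j₁ i₂ j₂ (u₁ , u₂) (v₁ , v₂) = bilinear i₁ j₁ i₂ j₂ u₁ u₂ v₁ v₂
      where
      bilinear : ∀ i₁ j₁ i₂ j₂ u₁ u₂ v₁ v₂ →
        (i₁ * u₁ + j₁ * v₁) * (i₂ * u₂ + j₂ * v₂) - (i₁ * u₂ + j₁ * v₂) * (i₂ * u₁ + j₂ * v₁)
        ≡ (i₁ * j₂ - j₁ * i₂) * (u₁ * v₂ - u₂ * v₁)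
      bilinear = solve-∀

    √-d-*R : ∀ m → (+ 0 , + 1) *R (m , + 0) ≡ (+ 0 , m)
    √-d-*R m = cong₂ _,_ (re (+ d) m) (im m)
      where
      re : ∀ D m → + 0 * m - D * (+ 1 * + 0) ≡ + 0
      re = solve-∀
      im : ∀ m → + 0 * + 0 + + 1 * m ≡ m
      im = solve-∀

    -R-anticomm : ∀ x y → y -R x ≡ -R (x -R y)
    -R-anticomm (x₁ , x₂) (y₁ , y₂) = cong₂ _,_ (flip y₁ x₁) (flip y₂ x₂)
      where
      flip : ∀ a b → a - b ≡ - (b - a)
      flip = solve-∀

    -R-telescope : ∀ x y z → (x -R y) +R (y -R z) ≡ x -R z
    -R-telescope (x₁ , x₂) (y₁ , y₂) (z₁ , z₂) = cong₂ _,_ (tele x₁ y₁ z₁) (tele x₂ y₂ z₂)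
      where
      tele : ∀ a b c → (a - b) + (b - c) ≡ a - c
      tele = solve-∀

    +R-cancelˡ : ∀ e c → (e +R c) -R e ≡ c
    +R-cancelˡ (e₁ , e₂) (c₁ , c₂) = cong₂ _,_ (cancel e₁ c₁) (cancel e₂ c₂)
      where
      cancel : ∀ e c → (e + c) - e ≡ c
      cancel = solve-∀

    +R-cancelʳ : ∀ e c → (e +R c) -R c ≡ e
    +R-cancelʳ (e₁ , e₂) (c₁ , c₂) = cong₂ _,_ (cancel e₁ c₁) (cancel e₂ c₂)
      where
      cancel : ∀ e c → (e + c) - c ≡ e
      cancel = solve-∀

    module Closure (I : Ideal) where
      ·∈ : ∀ k {x} → Mem I x → Mem I (k · x)
      ·∈ k {x} x∈ = subst (Mem I) (scalar-*R k x) (*∈ I (k , + 0) x∈)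

      -∈ : ∀ {x} → Mem I x → Mem I (-R x)
      -∈ {x} x∈ = subst (Mem I) (cong₂ _,_ (ℤP.-1*i≡-i _) (ℤP.-1*i≡-i _)) (·∈ (- + 1) x∈)

      -R∈ : ∀ {x y} → Mem I x → Mem I y → Mem I (x -R y)
      -R∈ x∈ y∈ = +∈ I x∈ (-∈ y∈)

      ≡[mod]-sym : ∀ {x y} → Mem I (x -R y) → Mem I (y -R x)
      ≡[mod]-sym {x} {y} m = subst (Mem I) (sym (-R-anticomm x y)) (-∈ m)

      ≡[mod]-trans : ∀ {x y z} → Mem I (x -R y) → Mem I (y -R z) → Mem I (x -R z)
      ≡[mod]-trans {x} {y} {z} m m' = subst (Mem I) (-R-telescope x y z) (+∈ I m m')

    ⟨_⟩ : ℤ[√- d ] → Ideal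
    ⟨ α ⟩ = record
      { Mem = λ x → Σ ℤ[√- d ] λ q → q *R α ≡ x
      ; 0∈ = 0R , *R-zeroˡ α
      ; +∈ = λ { (q , refl) (q' , refl) → q +R q' , *R-distribʳ-+R q q' α }
      ; *∈ = λ { r (q , refl) → r *R q , *R-assoc r q α }
      }

    generator∈ : ∀ α → Mem ⟨ α ⟩ α
    generator∈ α = (+ 1 , + 0) , *R-identityˡ α

    same-refl : ∀ {I} → SameIdeal I I
    same-refl x = (λ m → m) , (λ m → m)

    same-trans : ∀ {I J K} → SameIdeal I J → SameIdeal J K → SameIdeal I K
    same-trans I≈J J≈K x = (λ m → proj₁ (J≈K x) (proj₁ (I≈J x) m)) , (λ m → proj₂ (I≈J x) (proj₂ (J≈K x) m))

  -- An ideal I of ℤ[√-d] with decidable membership that contains M and M√-d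
  -- (M > 0) is a full lattice in ℤ².  It has the Hermite basis (g , t), (0 , h):
  -- h > 0 is least with h√-d ∈ I, g > 0 is the least positive first coordinate.
  -- The pairs (r , ρ) ∈ [0,g) × [0,h) represent the classes of ℤ[√-d] / I
  -- exactly once, so |ℤ[√-d] / I| = g·h.
  module Lattice (d : ℕ) (I : Ring.Ideal d) (dec : ∀ x → Dec (Ring.Mem I x))
                 (M' : ℕ) (M∈ : Ring.Mem I (+ suc M' , + 0)) (M√-d∈ : Ring.Mem I (+ 0 , + suc M')) where
    open Arithmetic d
    open Closure I

    M : ℕ
    M = suc M'

    h-search : Least (λ k → Mem I (+ 0 , + suc k))
    h-search = least (λ k → dec _) M' M√-d∈

    h : ℕ
    h = suc (proj₁ h-search)

    h√-d∈ : Mem I (+ 0 , + h)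
    h√-d∈ = proj₁ (proj₂ h-search)

    -- The search for g ranges over second coordinates in [0, M), which suffices
    -- since M√-d ∈ I.
    g-search : Least (λ k → Σ (Fin M) λ y → Mem I (+ suc k , + toℕ y))
    g-search = least (λ k → FinP.any? (λ y → dec _)) M' (Fin.zero , M∈)

    g : ℕ
    g = suc (proj₁ g-search)

    t : ℤ
    t = + toℕ (proj₁ (proj₁ (proj₂ g-search)))

    gt∈ : Mem I (+ g , t)
    gt∈ = proj₂ (proj₁ (proj₂ g-search))

    first-coordinate-zero : ∀ r v → r < g → Mem I (+ r , v) → r ≡ 0
    first-coordinate-zero zero v _ _ = refl
    first-coordinate-zero (suc r) v r<g x∈ =
      ⊥-elim (proj₂ (proj₂ g-search) r (ℕP.≤-pred r<g) (fromℕ< (n%ℕd<d v M) , reduced))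
      where
      q = v /ℕ M
      drop-zero : ∀ a q → a - q * + 0 ≡ a
      drop-zero = solve-∀
      reduced : Mem I (+ suc r , + toℕ (fromℕ< (n%ℕd<d v M)))
      reduced = subst (Mem I)
        (cong₂ _,_ (drop-zero (+ suc r) q)
                   (trans (minus-multiple q (+ M) (a≡a%ℕn+[a/ℕn]*n v M))
                          (cong +_ (sym (FinP.toℕ-fromℕ< (n%ℕd<d v M))))))
        (-R∈ x∈ (·∈ q M√-d∈))

    second-coordinate-zero : ∀ s → s < h → Mem I (+ 0 , + s) → s ≡ 0
    second-coordinate-zero zero _ _ = refl
    second-coordinate-zero (suc s) s<h x∈ = ⊥-elim (proj₂ (proj₂ h-search) s (ℕP.≤-pred s<h) x∈)

    combination : ℤ → ℤ → ℤ[√- d ]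
    combination i j = (i · (+ g , t)) +R (j · (+ 0 , + h))

    combination∈ : ∀ i j → Mem I (combination i j)
    combination∈ i j = +∈ I (·∈ i gt∈) (·∈ j h√-d∈)

    quotient₁ : ℤ[√- d ] → ℤ
    quotient₁ (x₁ , _) = x₁ /ℕ g

    shifted : ℤ[√- d ] → ℤ
    shifted x@(_ , x₂) = x₂ - quotient₁ x * t

    quotient₂ : ℤ[√- d ] → ℤ
    quotient₂ x = shifted x /ℕ h

    residue : ℤ[√- d ] → Fin g × Fin h
    residue x@(x₁ , _) = fromℕ< (n%ℕd<d x₁ g) , fromℕ< (n%ℕd<d (shifted x) h)

    embed : Fin g × Fin h → ℤ[√- d ]
    embed (r , ρ) = (+ toℕ r , + toℕ ρ)

    division : ∀ x → x ≡ embed (residue x) +R combination (quotient₁ x) (quotient₂ x)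
    division x@(x₁ , x₂) = cong₂ _,_
      (begin
        x₁                      ≡⟨ a≡a%ℕn+[a/ℕn]*n x₁ g ⟩
        + r + i * + g            ≡⟨ pad (+ r) i (+ g) j ⟩
        + r + (i * + g + j * + 0) ≡⟨ cong (λ z → + z + (i * + g + j * + 0)) (FinP.toℕ-fromℕ< _) ⟨
        + toℕ (proj₁ (residue x)) + (i * + g + j * + 0) ∎)
      (begin
        x₂                      ≡⟨ unshift x₂ (i * t) ⟩
        shifted x + i * t       ≡⟨ cong (_+ i * t) (a≡a%ℕn+[a/ℕn]*n (shifted x) h) ⟩
        + ρ + j * + h + i * t    ≡⟨ regroup (+ ρ) (j * + h) (i * t) ⟩
        + ρ + (i * t + j * + h)  ≡⟨ cong (λ z → + z + (i * t + j * + h)) (FinP.toℕ-fromℕ< _) ⟨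
        + toℕ (proj₂ (residue x)) + (i * t + j * + h) ∎)
      where
      open ≡-Reasoning
      i = quotient₁ x
      j = quotient₂ x
      r = x₁ %ℕ g
      ρ = shifted x %ℕ h
      pad : ∀ r i g j → r + i * g ≡ r + (i * g + j * + 0)
      pad = solve-∀
      unshift : ∀ a b → a ≡ (a - b) + b
      unshift = solve-∀
      regroup : ∀ a b c → a + b + c ≡ a + (c + b)
      regroup = solve-∀

    residue-congruent : ∀ x → Mem I (x -R embed (residue x))
    residue-congruent x = subst (Mem I) (trans (sym (+R-cancelˡ e c)) (cong (_-R e) (sym (division x))))
                            (combination∈ (quotient₁ x) (quotient₂ x))
      where
      e = embed (residue x)
      c = combination (quotient₁ x) (quotient₂ x)

    decompose : ∀ x → Mem I x → Σ ℤ λ i → Σ ℤ λ j → x ≡ combination i j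
    decompose x x∈ = i , j , (begin
        x                                        ≡⟨ division x ⟩
        embed (residue x) +R combination i j      ≡⟨ cong (_+R combination i j) rep≡0 ⟩
        0R +R combination i j                     ≡⟨ cong₂ _,_ (ℤP.+-identityˡ _) (ℤP.+-identityˡ _) ⟩
        combination i j                          ∎)
      where
      open ≡-Reasoning
      i = quotient₁ x
      j = quotient₂ x
      rep = embed (residue x)
      rep∈ : Mem I rep
      rep∈ = subst (Mem I) (trans (cong (_-R combination i j) (division x)) (+R-cancelʳ rep (combination i j)))
               (-R∈ x∈ (combination∈ i j))
      r≡0 : toℕ (proj₁ (residue x)) ≡ 0
      r≡0 = first-coordinate-zero _ _ (FinP.toℕ<n _) rep∈
      ρ≡0 : toℕ (proj₂ (residue x)) ≡ 0
      ρ≡0 = second-coordinate-zero _ (FinP.toℕ<n _) (subst (λ z → Mem I (+ z , + toℕ (proj₂ (residue x)))) r≡0 rep∈)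
      rep≡0 : rep ≡ 0R
      rep≡0 = cong₂ (λ a b → (+ a , + b)) r≡0 ρ≡0

    -- Distinct residues are incongruent modulo I: if (a - a' , b - b') = i·(g , t) + j·h√-d
    -- then comparing first coordinates gives i = 0 and a = a', and then j = 0 and b = b'.
    residues-distinct : ∀ u v → Mem I (embed u -R embed v) → u ≡ v
    residues-distinct (a , b) (a' , b') m = cong₂ _,_ (FinP.toℕ-injective a≡a') (FinP.toℕ-injective b≡b')
      where
      i = proj₁ (decompose (embed (a , b) -R embed (a' , b')) m)
      j = proj₁ (proj₂ (decompose (embed (a , b) -R embed (a' , b')) m))
      e : embed (a , b) -R embed (a' , b') ≡ combination i j
      e = proj₂ (proj₂ (decompose (embed (a , b) -R embed (a' , b')) m))
      drop : ∀ i j g → i * g + j * + 0 ≡ i * g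
      drop = solve-∀
      first : + toℕ a ≡ + toℕ a' + i * + g
      first = from-difference {y = + toℕ a'} (trans (cong proj₁ e) (drop i j (+ g)))
      first-coordinates = residue-unique i (FinP.toℕ<n a) (FinP.toℕ<n a') first
      a≡a' : toℕ a ≡ toℕ a'
      a≡a' = proj₁ first-coordinates
      vanish : ∀ t j h → + 0 * t + j * h ≡ j * h
      vanish = solve-∀
      second : + toℕ b ≡ + toℕ b' + j * + h
      second = from-difference {y = + toℕ b'} (trans (cong proj₂ e)
                 (trans (cong (λ z → z * t + j * + h) (proj₂ first-coordinates)) (vanish t j (+ h))))
      b≡b' : toℕ b ≡ toℕ b'
      b≡b' = proj₁ (residue-unique j (FinP.toℕ<n b) (FinP.toℕ<n b') second)

    index : ℤ[√- d ] → Fin (g ℕ.* h)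
    index x = combine (proj₁ (residue x)) (proj₂ (residue x))

    same-index⇒congruent : ∀ x y → index x ≡ index y → Mem I (x -R y)
    same-index⇒congruent x y e = ≡[mod]-trans {x} {embed (residue x)} (residue-congruent x)
      (subst (λ z → Mem I (embed z -R y)) (sym same-residue) (≡[mod]-sym {y} (residue-congruent y)))
      where
      same-residue : residue x ≡ residue y
      same-residue = let (r≡ , ρ≡) = FinP.combine-injective _ _ _ _ e in cong₂ _,_ r≡ ρ≡

    congruent⇒same-index : ∀ x y → Mem I (x -R y) → index x ≡ index y
    congruent⇒same-index x y m = cong (λ z → combine (proj₁ z) (proj₂ z))
      (residues-distinct (residue x) (residue y)
        (≡[mod]-trans {embed (residue x)} {x} (≡[mod]-sym {x} (residue-congruent x))
                      (≡[mod]-trans {x} {y} m (residue-congruent y))))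

    index-surjective : ∀ k → Σ ℤ[√- d ] λ x → index x ≡ k
    index-surjective k with FinP.combine-surjective k
    ... | r , ρ , e = embed (r , ρ) , trans (cong (λ z → combine (proj₁ z) (proj₂ z)) rep) e
      where
      rep : residue (embed (r , ρ)) ≡ (r , ρ)
      rep = residues-distinct (residue (embed (r , ρ))) (r , ρ)
              (≡[mod]-sym {embed (r , ρ)} {embed (residue (embed (r , ρ)))} (residue-congruent (embed (r , ρ))))

    quotient-card : QuotientCard I (g ℕ.* h)
    quotient-card = index , index-surjective , λ x y → same-index⇒congruent x y , congruent⇒same-index x y

  -- Membership in ⟨α⟩ is
  -- decidable (x ∈ ⟨α⟩ iff N divides x·conj α), and ⟨α⟩ ∋ N, N√-d, so ⟨α⟩ is a
  -- lattice with basis (g , t), (0 , h).  Comparing determinants of two bases of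
  -- ⟨α⟩ shows g·h ∣ N and N ∣ g·h.
  module PrincipalIdeal (d : ℕ) (α : ℤ × ℤ) (N' : ℕ) (normα : Arithmetic.norm d α ≡ suc N') where
    open Arithmetic d

    N : ℕ
    N = suc N'

    normℤα : normℤ α ≡ + N
    normℤα = trans (sym (norm-normℤ α)) (cong +_ normα)

    ·-cancel : ∀ {u v} → + N · u ≡ + N · v → u ≡ v
    ·-cancel {u₁ , u₂} {v₁ , v₂} e =
      cong₂ _,_ (ℤP.*-cancelˡ-≡ (+ N) u₁ v₁ (cong proj₁ e)) (ℤP.*-cancelˡ-≡ (+ N) u₂ v₂ (cong proj₂ e))

    member? : ∀ x → Dec (Mem ⟨ α ⟩ x)
    member? x = map′ divisible⇒member member⇒divisible ((+ N ∣? proj₁ c) ×-dec (+ N ∣? proj₂ c))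
      where
      c = x *R conj α
      divisible⇒member : (+ N ∣ proj₁ c) × (+ N ∣ proj₂ c) → Mem ⟨ α ⟩ x
      divisible⇒member (divides q₁ e₁ , divides q₂ e₂) = q , ·-cancel (begin
        + N · (q *R α)  ≡⟨ ·-*R (+ N) q α ⟨
        (+ N · q) *R α  ≡⟨ cong (_*R α) (cong₂ _,_ (trans (ℤP.*-comm (+ N) q₁) (sym e₁))
                                                   (trans (ℤP.*-comm (+ N) q₂) (sym e₂))) ⟩
        c *R α          ≡⟨ conj-cancelʳ x α ⟩
        normℤ α · x     ≡⟨ cong (_· x) normℤα ⟩
        + N · x         ∎)
        where
        open ≡-Reasoning
        q = (q₁ , q₂)
      member⇒divisible : Mem ⟨ α ⟩ x → (+ N ∣ proj₁ c) × (+ N ∣ proj₂ c)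
      member⇒divisible (q , refl) =
        divides (proj₁ q) (trans (cong proj₁ N·q) (ℤP.*-comm (+ N) (proj₁ q))) ,
        divides (proj₂ q) (trans (cong proj₂ N·q) (ℤP.*-comm (+ N) (proj₂ q)))
        where
        N·q : c ≡ + N · q
        N·q = trans (conj-cancelˡ q α) (cong (_· q) normℤα)

    -- N = (1 · conj α) · α and N√-d = √-d · N lie in ⟨α⟩.
    N∈ : Mem ⟨ α ⟩ (+ N , + 0)
    N∈ = (+ 1 , + 0) *R conj α , trans (conj-cancelʳ (+ 1 , + 0) α)
           (cong₂ _,_ (trans (cong (_* + 1) normℤα) (ℤP.*-identityʳ (+ N))) (ℤP.*-zeroʳ (normℤ α)))

    N√-d∈ : Mem ⟨ α ⟩ (+ 0 , + N)
    N√-d∈ = subst (Mem ⟨ α ⟩) (√-d-*R (+ N)) (*∈ ⟨ α ⟩ (+ 0 , + 1) N∈)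

    open Lattice d ⟨ α ⟩ member? N' N∈ N√-d∈

    det-basis : det (+ g , t) (+ 0 , + h) ≡ + (g ℕ.* h)
    det-basis = trans (drop (+ g) t (+ h)) (sym (ℤP.pos-* g h))
      where
      drop : ∀ g t h → g * h - t * + 0 ≡ g * h
      drop = solve-∀

    -- The basis vectors are multiples of α, so N divides their determinant g·h.
    N∣gh : N ℕ∣.∣ g ℕ.* h
    N∣gh = ∣⇒∣ᵤ (divides (det qg qh) (begin
      + (g ℕ.* h)               ≡⟨ det-basis ⟨
      det (+ g , t) (+ 0 , + h) ≡⟨ cong₂ det (proj₂ gt∈) (proj₂ h√-d∈) ⟨
      det (qg *R α) (qh *R α)   ≡⟨ det-*R qg qh α ⟩
      det qg qh * normℤ α       ≡⟨ cong (det qg qh *_) normℤα ⟩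
      det qg qh * + N           ∎))
      where
      open ≡-Reasoning
      qg = proj₁ gt∈
      qh = proj₁ h√-d∈

    -- α and √-d·α lie in the lattice and have determinant N, so g·h divides N.
    gh∣N : g ℕ.* h ℕ∣.∣ N
    gh∣N = ∣⇒∣ᵤ (divides (i₁ * j₂ - j₁ * i₂) (begin
      + N                                                 ≡⟨ ℤP.*-identityˡ (+ N) ⟨
      + 1 * + N                                           ≡⟨ cong (+ 1 *_) normℤα ⟨
      det (+ 1 , + 0) (+ 0 , + 1) * normℤ α                ≡⟨ det-*R (+ 1 , + 0) (+ 0 , + 1) α ⟨
      det ((+ 1 , + 0) *R α) ((+ 0 , + 1) *R α)           ≡⟨ cong₂ det e₁ e₂ ⟩
      det (combination i₁ j₁) (combination i₂ j₂)         ≡⟨ det-combination i₁ j₁ i₂ j₂ (+ g , t) (+ 0 , + h) ⟩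
      (i₁ * j₂ - j₁ * i₂) * det (+ g , t) (+ 0 , + h)      ≡⟨ cong ((i₁ * j₂ - j₁ * i₂) *_) det-basis ⟩
      (i₁ * j₂ - j₁ * i₂) * + (g ℕ.* h)                   ∎))
      where
      open ≡-Reasoning
      α-coordinates = decompose ((+ 1 , + 0) *R α) ((+ 1 , + 0) , refl)
      √-dα-coordinates = decompose ((+ 0 , + 1) *R α) ((+ 0 , + 1) , refl)
      i₁ = proj₁ α-coordinates
      j₁ = proj₁ (proj₂ α-coordinates)
      e₁ : (+ 1 , + 0) *R α ≡ combination i₁ j₁
      e₁ = proj₂ (proj₂ α-coordinates)
      i₂ = proj₁ √-dα-coordinates
      j₂ = proj₁ (proj₂ √-dα-coordinates)
      e₂ : (+ 0 , + 1) *R α ≡ combination i₂ j₂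
      e₂ = proj₂ (proj₂ √-dα-coordinates)

    quotient-card-principal : QuotientCard ⟨ α ⟩ N
    quotient-card-principal = subst (QuotientCard ⟨ α ⟩) (ℕ∣.∣-antisym gh∣N N∣gh) quotient-card

  module QuotientFacts (d : ℕ) where
    open Arithmetic d

    x-R0 : ∀ x → x -R 0R ≡ x
    x-R0 (a , b) = cong₂ _,_ (ℤP.+-identityʳ a) (ℤP.+-identityʳ b)

    -- The index of an ideal is well defined: a quotient map onto Fin a injects
    -- Fin a into Fin b through any other quotient map onto Fin b.
    card-≤ : ∀ {I a b} → QuotientCard I a → QuotientCard I b → a ≤ b
    card-≤ (f , f-onto , f-fibres) (f' , _ , f'-fibres) = FinP.injective⇒≤ injective
      where
      injective : ∀ {k l} → f' (proj₁ (f-onto k)) ≡ f' (proj₁ (f-onto l)) → k ≡ l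
      injective {k} {l} e = trans (sym (proj₂ (f-onto k)))
        (trans (proj₂ (f-fibres _ _) (proj₁ (f'-fibres _ _) e)) (proj₂ (f-onto l)))

    card-transfer : ∀ {I J n} → SameIdeal I J → QuotientCard J n → QuotientCard I n
    card-transfer I≈J (f , onto , fibres) = f , onto , λ x y →
      (λ e → proj₂ (I≈J (x -R y)) (proj₁ (fibres x y) e)) , (λ m → proj₂ (fibres x y) (proj₁ (I≈J (x -R y)) m))

    -- Membership in an ideal of finite index is decidable: x ∈ I iff x ↦ 0 in R / I.
    member? : ∀ {I n} → QuotientCard I n → ∀ x → Dec (Mem I x)
    member? {I} (f , _ , fibres) x with f x Fin.≟ f 0R
    ... | yes e = yes (subst (Mem I) (x-R0 x) (proj₁ (fibres x 0R) e))
    ... | no ne = no λ m → ne (proj₂ (fibres x 0R) (subst (Mem I) (sym (x-R0 x)) m))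

    -- An ideal of finite index n contains a positive integer: two of 0, …, n
    -- have the same image in R / I.
    positive-integer∈ : ∀ {I n} → QuotientCard I n → Σ ℕ λ M' → Mem I (+ suc M' , + 0)
    positive-integer∈ {I} {n} (f , _ , fibres)
      with FinP.pigeonhole (ℕP.n<1+n n) (λ (k : Fin (suc n)) → f (+ toℕ k , + 0))
    ... | i , j , i<j , fi≡fj = toℕ j ℕ.∸ suc (toℕ i) ,
          subst (Mem I) (cong₂ _,_ difference refl) (proj₁ (fibres _ _) (sym fi≡fj))
      where
      difference : + toℕ j - + toℕ i ≡ + suc (toℕ j ℕ.∸ suc (toℕ i))
      difference = trans (ℤP.m-n≡m⊖n (toℕ j) (toℕ i))
        (trans (ℤP.⊖-≥ (ℕP.<⇒≤ i<j)) (cong +_ (ℕP.+-∸-assoc 1 {toℕ j} {suc (toℕ i)} i<j)))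

  -- ℤ[√-d] is norm-Euclidean for d ∈ {1, 2}, hence every ideal of finite index n
  -- is principal, generated by an element of norm n.
  module Euclidean (d : ℕ) (1≤d : 1 ≤ d) (d≤2 : d ≤ 2) where
    open Arithmetic d
    open QuotientFacts d

    instance
      d≢0 : ℕ.NonZero d
      d≢0 = ℕ.>-nonZero 1≤d

    norm≡0 : ∀ x → norm x ≡ 0 → x ≡ 0R
    norm≡0 (a , b) e = cong₂ _,_ (ℤP.∣i∣≡0⇒i≡0 (square≡0 _ (ℕP.m+n≡0⇒m≡0 _ e)))
      (ℤP.∣i∣≡0⇒i≡0 (square≡0 _ (ℕP.m*n≡0⇒m≡0 _ d (trans (ℕP.*-comm _ d) (ℕP.m+n≡0⇒n≡0 _ e)))))

    norm-conj : ∀ u → norm (conj u) ≡ norm u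
    norm-conj (a , b) = cong (λ z → ∣ a ∣ ℕ.* ∣ a ∣ ℕ.+ d ℕ.* (z ℕ.* z)) (ℤP.∣-i∣≡∣i∣ b)

    coordinate₁-≤ : ∀ a b → ∣ a ∣ ≤ norm (a , b)
    coordinate₁-≤ a b = ℕP.≤-trans (n≤n*n ∣ a ∣) (ℕP.m≤m+n _ _)

    coordinate₂-≤ : ∀ a b → ∣ b ∣ ≤ norm (a , b)
    coordinate₂-≤ a b = ℕP.≤-trans (n≤n*n ∣ b ∣) (ℕP.≤-trans (ℕP.m≤n*m _ d) (ℕP.m≤n+m _ _))

    small-norm : ∀ a b N → 2 ℕ.* a ≤ N → 2 ℕ.* b ≤ N → 4 ℕ.* (a ℕ.* a ℕ.+ d ℕ.* (b ℕ.* b)) ≤ 3 ℕ.* (N ℕ.* N)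
    small-norm a b N 2a≤N 2b≤N = begin
      4 ℕ.* (a ℕ.* a ℕ.+ d ℕ.* (b ℕ.* b))                         ≡⟨ double a b d ⟩
      (2 ℕ.* a) ℕ.* (2 ℕ.* a) ℕ.+ d ℕ.* ((2 ℕ.* b) ℕ.* (2 ℕ.* b))
        ≤⟨ ℕP.+-mono-≤ (ℕP.*-mono-≤ 2a≤N 2a≤N) (ℕP.*-mono-≤ d≤2 (ℕP.*-mono-≤ 2b≤N 2b≤N)) ⟩
      N ℕ.* N ℕ.+ 2 ℕ.* (N ℕ.* N)                                 ≡⟨ collect N ⟩
      3 ℕ.* (N ℕ.* N)                                             ∎
      where
      open ℕP.≤-Reasoning
      double : ∀ a b d → 4 ℕ.* (a ℕ.* a ℕ.+ d ℕ.* (b ℕ.* b)) ≡ (2 ℕ.* a) ℕ.* (2 ℕ.* a) ℕ.+ d ℕ.* ((2 ℕ.* b) ℕ.* (2 ℕ.* b))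
      double = ℕSolver.solve-∀
      collect : ∀ N → N ℕ.* N ℕ.+ 2 ℕ.* (N ℕ.* N) ≡ 3 ℕ.* (N ℕ.* N)
      collect = ℕSolver.solve-∀

    remainder-conj : ∀ x γ q e → x *R conj γ ≡ e +R (normℤ γ · q) → (x -R (q *R γ)) *R conj γ ≡ e
    remainder-conj x γ q e c≡ = begin
      (x -R (q *R γ)) *R conj γ                ≡⟨ *R-distribʳ--R x (q *R γ) (conj γ) ⟩
      (x *R conj γ) -R ((q *R γ) *R conj γ)    ≡⟨ cong₂ _-R_ c≡ (conj-cancelˡ q γ) ⟩
      (e +R (normℤ γ · q)) -R (normℤ γ · q)    ≡⟨ +R-cancelʳ e (normℤ γ · q) ⟩
      e                                        ∎
      where open ≡-Reasoning

    -- Euclidean division: for N(γ) = N > 0 there is q with N(x - qγ) < N.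
    -- Round x · conj γ / N coordinatewise to q; the error e satisfies
    -- N(x - qγ) · N = N(e) ≤ 3N²/4.
    euclidean-division : ∀ x γ {N'} → norm γ ≡ suc N' → Σ ℤ[√- d ] λ q → norm (x -R (q *R γ)) < suc N'
    euclidean-division x γ {N'} normγ
      with nearest-division (proj₁ (x *R conj γ)) (suc N') | nearest-division (proj₂ (x *R conj γ)) (suc N')
    ... | q₁ , e₁ , c₁≡ , small₁ | q₂ , e₂ , c₂≡ , small₂ = (q₁ , q₂) , remainder-small
      where
      N = suc N'
      ρ = x -R ((q₁ , q₂) *R γ)
      normℤγ : normℤ γ ≡ + N
      normℤγ = trans (sym (norm-normℤ γ)) (cong +_ normγ)
      ρ-conj : ρ *R conj γ ≡ (e₁ , e₂)
      ρ-conj = remainder-conj x γ (q₁ , q₂) (e₁ , e₂)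
        (cong₂ _,_ (trans c₁≡ (cong (λ z → e₁ + z) (trans (ℤP.*-comm q₁ (+ N)) (cong (_* q₁) (sym normℤγ)))))
                   (trans c₂≡ (cong (λ z → e₂ + z) (trans (ℤP.*-comm q₂ (+ N)) (cong (_* q₂) (sym normℤγ))))))
      normρ·N : norm ρ ℕ.* N ≡ norm (e₁ , e₂)
      normρ·N = begin
        norm ρ ℕ.* N                ≡⟨ cong (norm ρ ℕ.*_) (trans (norm-conj γ) normγ) ⟨
        norm ρ ℕ.* norm (conj γ)    ≡⟨ norm-*R ρ (conj γ) ⟨
        norm (ρ *R conj γ)          ≡⟨ cong norm ρ-conj ⟩
        norm (e₁ , e₂)              ∎
        where open ≡-Reasoning
      4normρ≤3N : 4 ℕ.* norm ρ ≤ 3 ℕ.* N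
      4normρ≤3N = ℕP.*-cancelʳ-≤ (4 ℕ.* norm ρ) (3 ℕ.* N) N
        (subst₂ _≤_ (trans (cong (4 ℕ.*_) (sym normρ·N)) (sym (ℕP.*-assoc 4 (norm ρ) N)))
                    (sym (ℕP.*-assoc 3 N N)) (small-norm ∣ e₁ ∣ ∣ e₂ ∣ N small₁ small₂))
      remainder-small : norm ρ < N
      remainder-small with norm ρ ℕ.<? N
      ... | yes lt = lt
      ... | no ≮ = ⊥-elim (ℕP.<⇒≱ (ℕP.*-monoˡ-< N {3} {4} (ℕP.n<1+n 3))
                     (ℕP.≤-trans (ℕP.*-monoʳ-≤ 4 (ℕP.≮⇒≥ ≮)) 4normρ≤3N))

    generated-by-least : ∀ (I : Ideal) γ {N'} → Mem I γ → norm γ ≡ suc N' →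
      (∀ x → Mem I x → norm x < suc N' → x ≡ 0R) → SameIdeal I ⟨ γ ⟩
    generated-by-least I γ γ∈ normγ minimal x = multiple , λ { (q , refl) → *∈ I q γ∈ }
      where
      open Closure I
      multiple : Mem I x → Mem ⟨ γ ⟩ x
      multiple x∈ with euclidean-division x γ normγ
      ... | q , small = q , sym (cong₂ _,_ (ℤP.i-j≡0⇒i≡j _ _ (cong proj₁ ρ≡0)) (ℤP.i-j≡0⇒i≡j _ _ (cong proj₂ ρ≡0)))
        where
        ρ≡0 : x -R (q *R γ) ≡ 0R
        ρ≡0 = minimal _ (-R∈ x∈ (*∈ I q γ∈)) small

    signed : Fin 2 → ℕ → ℤ
    signed Fin.zero m = + m
    signed (Fin.suc _) m = - + m

    signed-abs : ∀ a → Σ (Fin 2) λ s → signed s ∣ a ∣ ≡ a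
    signed-abs (+ m) = Fin.zero , refl
    signed-abs -[1+ m ] = Fin.suc Fin.zero , refl

    -- Elements of norm k+1 have coordinates in [-(k+1), k+1], so whether an ideal
    -- with decidable membership has such an element is decidable.
    module LeastNorm (I : Ideal) (dec : ∀ x → Dec (Mem I x)) where
      ElementOfNorm : ℕ → Set
      ElementOfNorm k = Σ ℤ[√- d ] λ x → Mem I x × norm x ≡ suc k

      Candidate : ℕ → Set
      Candidate k = Σ (Fin 2) λ s₁ → Σ (Fin (suc (suc k))) λ m₁ → Σ (Fin 2) λ s₂ → Σ (Fin (suc (suc k))) λ m₂ →
        let x = (signed s₁ (toℕ m₁) , signed s₂ (toℕ m₂)) in Mem I x × norm x ≡ suc k

      candidate-found : ∀ {k} → Candidate k → ElementOfNorm k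
      candidate-found (s₁ , m₁ , s₂ , m₂ , found) = _ , found

      candidate-exists : ∀ {k} → ElementOfNorm k → Candidate k
      candidate-exists {k} ((a , b) , x∈ , normx) = s₁ , m₁ , s₂ , m₂ , subst (Mem I) (sym x≡) x∈ , trans (cong norm x≡) normx
        where
        s₁ = proj₁ (signed-abs a)
        s₂ = proj₁ (signed-abs b)
        m₁ : Fin (suc (suc k))
        m₁ = fromℕ< (s≤s (subst (∣ a ∣ ≤_) normx (coordinate₁-≤ a b)))
        m₂ : Fin (suc (suc k))
        m₂ = fromℕ< (s≤s (subst (∣ b ∣ ≤_) normx (coordinate₂-≤ a b)))
        x≡ : (signed s₁ (toℕ m₁) , signed s₂ (toℕ m₂)) ≡ (a , b)
        x≡ = cong₂ _,_ (trans (cong (signed s₁) (FinP.toℕ-fromℕ< _)) (proj₂ (signed-abs a)))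
                       (trans (cong (signed s₂) (FinP.toℕ-fromℕ< _)) (proj₂ (signed-abs b)))

      element-of-norm? : ∀ k → Dec (ElementOfNorm k)
      element-of-norm? k = map′ candidate-found candidate-exists
        (FinP.any? λ s₁ → FinP.any? λ m₁ → FinP.any? λ s₂ → FinP.any? λ m₂ →
          let x = (signed s₁ (toℕ m₁) , signed s₂ (toℕ m₂)) in dec x ×-dec (norm x ℕ.≟ suc k))

      least-norm-element : ∀ {k} → ElementOfNorm k →
        Σ ℤ[√- d ] λ γ → Σ ℕ λ N' → Mem I γ × norm γ ≡ suc N' × (∀ x → Mem I x → norm x < suc N' → x ≡ 0R)
      least-norm-element {k} witness with least element-of-norm? k witness
      ... | N' , (γ , γ∈ , normγ) , smaller-absent = γ , N' , γ∈ , normγ , minimal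
        where
        minimal : ∀ x → Mem I x → norm x < suc N' → x ≡ 0R
        minimal x x∈ lt with norm x in normx
        ... | zero = norm≡0 x normx
        ... | suc j = ⊥-elim (smaller-absent j (ℕP.≤-pred lt) (x , x∈ , normx))

    principal : ∀ (I : Ideal) n → HasNorm I n → Σ ℤ[√- d ] λ γ → SameIdeal I ⟨ γ ⟩ × norm γ ≡ n
    principal I n (_ , card) with positive-integer∈ {I} card
    ... | M' , M∈ with LeastNorm.least-norm-element I (member? {I} card) ((+ suc M' , + 0) , M∈ , refl)
    ...   | γ , N' , γ∈ , normγ , minimal = γ , I≈⟨γ⟩ , trans normγ (ℕP.≤-antisym (card-≤ {I} card-γ card) (card-≤ {I} card card-γ))
      where
      I≈⟨γ⟩ : SameIdeal I ⟨ γ ⟩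
      I≈⟨γ⟩ = generated-by-least I γ γ∈ normγ minimal
      card-γ : QuotientCard I (suc N')
      card-γ = card-transfer {I} {⟨ γ ⟩} I≈⟨γ⟩ (PrincipalIdeal.quotient-card-principal d γ N' normγ)

  length-empty : ∀ {A : Set} (xs : List A) → (∀ v → v ∉ xs) → length xs ≡ 0
  length-empty [] _ = refl
  length-empty (x ∷ xs) none = ⊥-elim (none x (here refl))

  length-singleton : ∀ {A : Set} (xs : List A) v → Unique xs → v ∈ xs → (∀ w → w ∈ xs → w ≡ v) → length xs ≡ 1
  length-singleton (a ∷ []) _ _ _ _ = refl
  length-singleton (a ∷ b ∷ xs) v ((a≢b ∷ _) ∷ _) _ only-v =
    ⊥-elim (a≢b (trans (only-v a (here refl)) (sym (only-v b (there (here refl))))))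

  lookup-injective : ∀ {A : Set} {xs : List A} → Unique xs → ∀ i j → lookup xs i ≡ lookup xs j → i ≡ j
  lookup-injective {xs = _ ∷ _} _ Fin.zero Fin.zero _ = refl
  lookup-injective {xs = _ ∷ _} (x∉ ∷ _) Fin.zero (Fin.suc j) e = ⊥-elim (All.lookup x∉ (∈P.∈-lookup j) e)
  lookup-injective {xs = _ ∷ _} (x∉ ∷ _) (Fin.suc i) Fin.zero e = ⊥-elim (All.lookup x∉ (∈P.∈-lookup i) (sym e))
  lookup-injective {xs = _ ∷ _} (_ ∷ unique) (Fin.suc i) (Fin.suc j) e = cong Fin.suc (lookup-injective unique i j e)

  -- Counting the generators (+x , ±k·y) attached to the representations
  -- n = x² + c·y²: one generator when y = 0, two otherwise.
  module Counting (c k' n : ℕ) (1≤c : 1 ≤ c) where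
    k : ℕ
    k = suc k'

    is-representation? : (p : ℕ × ℕ) → Dec (proj₁ p ℕ.* proj₁ p ℕ.+ c ℕ.* (proj₂ p ℕ.* proj₂ p) ≡ n)
    is-representation? p = (proj₁ p ℕ.* proj₁ p ℕ.+ c ℕ.* (proj₂ p ℕ.* proj₂ p)) ℕ.≟ n

    representations : List (ℕ × ℕ)
    representations = filter is-representation? (cartesianProduct (upTo (suc n)) (upTo (suc n)))

    representations-unique : Unique representations
    representations-unique = UniqueP.filter⁺ is-representation?
      (UniqueP.cartesianProduct⁺ (UniqueP.upTo⁺ (suc n)) (UniqueP.upTo⁺ (suc n)))

    representation∈ : ∀ x y → x ℕ.* x ℕ.+ c ℕ.* (y ℕ.* y) ≡ n → (x , y) ∈ representations
    representation∈ x y e = ∈P.∈-filter⁺ is-representation?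
      (∈P.∈-cartesianProduct⁺ (∈P.∈-upTo⁺ (s≤s x≤n)) (∈P.∈-upTo⁺ (s≤s y≤n))) e
      where
      x≤n : x ≤ n
      x≤n = subst (x ≤_) e (ℕP.≤-trans (n≤n*n x) (ℕP.m≤m+n _ _))
      y≤n : y ≤ n
      y≤n = subst (y ≤_) e (ℕP.≤-trans (n≤n*n y) (ℕP.≤-trans (ℕP.m≤n*m _ c {{ℕ.>-nonZero 1≤c}}) (ℕP.m≤n+m _ _)))

    ∈representations : ∀ {p} → p ∈ representations → proj₁ p ℕ.* proj₁ p ℕ.+ c ℕ.* (proj₂ p ℕ.* proj₂ p) ≡ n
    ∈representations p∈ = proj₂ (∈P.∈-filter⁻ is-representation? {xs = cartesianProduct (upTo (suc n)) (upTo (suc n))} p∈)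

    lift : ℕ × ℕ → List (ℤ × ℤ)
    lift (x , zero) = (+ x , + 0) ∷ []
    lift (x , suc y) = (+ x , + (k ℕ.* suc y)) ∷ (+ x , - + (k ℕ.* suc y)) ∷ []

    generators : List (ℤ × ℤ)
    generators = concatMap lift representations

    on-axis? : (p : ℕ × ℕ) → Dec (proj₂ p ≡ 0)
    on-axis? p = proj₂ p ℕ.≟ 0

    length-lifts : ∀ xs → length (concatMap lift xs) ℕ.+ length (filter on-axis? xs) ≡ 2 ℕ.* length xs
    length-lifts [] = refl
    length-lifts ((x , zero) ∷ ps) = trans (ℕP.+-suc (suc (length (concatMap lift ps))) _)
      (trans (cong (λ m → suc (suc m)) (length-lifts ps)) (sym (ℕP.*-distribˡ-+ 2 1 (length ps))))
    length-lifts ((x , suc y) ∷ ps) =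
      trans (cong (λ m → suc (suc m)) (length-lifts ps)) (sym (ℕP.*-distribˡ-+ 2 1 (length ps)))

    on-axis : ∀ {p} → p ∈ filter on-axis? representations → proj₁ p ℕ.* proj₁ p ≡ n × proj₂ p ≡ 0
    on-axis {x , y} p∈ with ∈P.∈-filter⁻ on-axis? {xs = representations} p∈
    ... | p∈reps , refl = trans (sym (trans (cong (x ℕ.* x ℕ.+_) (ℕP.*-zeroʳ c)) (ℕP.+-identityʳ _))) (∈representations p∈reps) , refl

    on-axis-square : ∀ r → r ℕ.* r ≡ n → length (filter on-axis? representations) ≡ 1
    on-axis-square r e = length-singleton _ (r , 0) (UniqueP.filter⁺ on-axis? representations-unique)
      (∈P.∈-filter⁺ on-axis? (representation∈ r 0 (trans (cong (r ℕ.* r ℕ.+_) (ℕP.*-zeroʳ c)) (trans (ℕP.+-identityʳ _) e))) refl)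
      λ w w∈ → cong₂ _,_ (square-injective _ r (trans (proj₁ (on-axis w∈)) (sym e))) (proj₂ (on-axis w∈))

    on-axis-nonsquare : ¬ IsSquare n → length (filter on-axis? representations) ≡ 0
    on-axis-nonsquare nonsquare = length-empty _ λ w w∈ → nonsquare (proj₁ w , proj₁ (on-axis w∈))

    count-square : IsSquare n → length generators ≡ 2 ℕ.* squarePairCount c n ℕ.∸ 1
    count-square (r , e) = begin
      length generators                                               ≡⟨ ℕP.m+n∸n≡m _ 1 ⟨
      length generators ℕ.+ 1 ℕ.∸ 1                                     ≡⟨ cong (λ m → length generators ℕ.+ m ℕ.∸ 1) (on-axis-square r e) ⟨
      length generators ℕ.+ length (filter on-axis? representations) ℕ.∸ 1 ≡⟨ cong (ℕ._∸ 1) (length-lifts representations) ⟩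
      2 ℕ.* squarePairCount c n ℕ.∸ 1                                  ∎
      where open ≡-Reasoning

    count-nonsquare : ¬ IsSquare n → length generators ≡ 2 ℕ.* squarePairCount c n
    count-nonsquare nonsquare = begin
      length generators                                           ≡⟨ ℕP.+-identityʳ _ ⟨
      length generators ℕ.+ 0                                       ≡⟨ cong (length generators ℕ.+_) (on-axis-nonsquare nonsquare) ⟨
      length generators ℕ.+ length (filter on-axis? representations) ≡⟨ length-lifts representations ⟩
      2 ℕ.* squarePairCount c n                                    ∎
      where open ≡-Reasoning

    Generator : ℤ × ℤ → Set
    Generator v = Σ ℕ λ x → Σ ℕ λ y → Σ ℤ λ b → v ≡ (+ x , b) × x ℕ.* x ℕ.+ c ℕ.* (y ℕ.* y) ≡ n × ∣ b ∣ ≡ k ℕ.* y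

    ∈lift : ∀ p {v} → v ∈ lift p → Σ ℤ λ b → v ≡ (+ proj₁ p , b) × ∣ b ∣ ≡ k ℕ.* proj₂ p
    ∈lift (x , zero) (here refl) = + 0 , refl , sym (ℕP.*-zeroʳ k)
    ∈lift (x , suc y) (here refl) = _ , refl , refl
    ∈lift (x , suc y) (there (here refl)) = _ , refl , ℤP.∣-i∣≡∣i∣ (+ (k ℕ.* suc y))

    lift∋ : ∀ x y b → ∣ b ∣ ≡ k ℕ.* y → (+ x , b) ∈ lift (x , y)
    lift∋ x zero (+ m) e = here (cong (λ z → (+ x , + z)) (trans e (ℕP.*-zeroʳ k)))
    lift∋ x zero -[1+ m ] e = ⊥-elim (ℕP.1+n≢0 (trans e (ℕP.*-zeroʳ k)))
    lift∋ x (suc y) (+ m) e = here (cong (λ z → (+ x , + z)) e)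
    lift∋ x (suc y) -[1+ m ] e = there (here (cong (λ z → (+ x , - + z)) e))

    ∈generators : ∀ {v} → v ∈ generators → Generator v
    ∈generators v∈ with find (∈P.∈-concatMap⁻ lift {xs = representations} v∈)
    ... | (x , y) , p∈ , v∈lift with ∈lift (x , y) v∈lift
    ...   | b , refl , |b| = x , y , b , refl , ∈representations p∈ , |b|

    generators∋ : ∀ x y b → x ℕ.* x ℕ.+ c ℕ.* (y ℕ.* y) ≡ n → ∣ b ∣ ≡ k ℕ.* y → (+ x , b) ∈ generators
    generators∋ x y b e |b| = ∈P.∈-concatMap⁺ lift (Any.map (λ { refl → lift∋ x y b |b| }) (representation∈ x y e))

    -- Lifts of different representations are disjoint, since (x , k·y) = (|v₁| , |v₂|).
    lift-disjoint : ∀ {p p' v} → v ∈ lift p → v ∈ lift p' → p ≡ p'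
    lift-disjoint {x , y} {x' , y'} v∈ v∈' with ∈lift (x , y) v∈ | ∈lift (x' , y') v∈'
    ... | b , refl , |b| | b' , e , |b'| =
      cong₂ _,_ (ℤP.+-injective (cong proj₁ e))
                (ℕP.*-cancelˡ-≡ y y' k (trans (sym |b|) (trans (cong ∣_∣ (cong proj₂ e)) |b'|)))

    lift-unique : ∀ p → Unique (lift p)
    lift-unique (x , zero) = [] ∷ []
    lift-unique (x , suc y) = ((λ ()) ∷ []) ∷ [] ∷ []

    lifts-unique : ∀ xs → Unique xs → Unique (concatMap lift xs)
    lifts-unique [] _ = []
    lifts-unique (p ∷ ps) (p∉ps ∷ ps-unique) = UniqueP.++⁺ (lift-unique p) (lifts-unique ps ps-unique) disjoint
      where
      disjoint : ∀ {v} → ¬ (v ∈ lift p × v ∈ concatMap lift ps)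
      disjoint (v∈ , v∈ps) with find (∈P.∈-concatMap⁻ lift {xs = ps} v∈ps)
      ... | p' , p'∈ps , v∈' = All.lookup p∉ps p'∈ps (lift-disjoint v∈ v∈')

    generators-unique : Unique generators
    generators-unique = lifts-unique representations representations-unique

  module Units (d : ℕ) (1≤d : 1 ≤ d) where
    open Arithmetic d

    sum≡1 : ∀ a b → a ℕ.+ b ≡ 1 → 1 ≤ b → a ≡ 0 × b ≡ 1
    sum≡1 zero b e _ = refl , e
    sum≡1 (suc a) b e 1≤b = ⊥-elim (ℕP.<⇒≢ 1≤b (sym (ℕP.m+n≡0⇒n≡0 a (ℕP.suc-injective e))))

    off-axis-unit : ∀ u₁ m → ∣ u₁ ∣ ℕ.* ∣ u₁ ∣ ℕ.+ d ℕ.* (suc m ℕ.* suc m) ≡ 1 → u₁ ≡ + 0 × suc m ≡ 1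
    off-axis-unit u₁ m e with sum≡1 _ _ e (ℕP.*-mono-≤ 1≤d (s≤s (z≤n {m ℕ.+ m ℕ.* suc m})))
    ... | u₁²≡0 , dm²≡1 = ℤP.∣i∣≡0⇒i≡0 (square≡0 _ u₁²≡0) , ℕP.m*n≡1⇒m≡1 (suc m) (suc m) (ℕP.m*n≡1⇒n≡1 d _ dm²≡1)

    unit-forms : ∀ u → norm u ≡ 1 → u ≡ (+ 1 , + 0) ⊎ u ≡ (- + 1 , + 0) ⊎ (proj₁ u ≡ + 0 × ∣ proj₂ u ∣ ≡ 1)
    unit-forms (u₁ , + zero) e
      with ℕP.m*n≡1⇒m≡1 ∣ u₁ ∣ ∣ u₁ ∣ (trans (sym (trans (cong (∣ u₁ ∣ ℕ.* ∣ u₁ ∣ ℕ.+_) (ℕP.*-zeroʳ d)) (ℕP.+-identityʳ _))) e)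
    unit-forms (+ .1 , + zero) e | refl = inj₁ refl
    unit-forms (-[1+ zero ] , + zero) e | refl = inj₂ (inj₁ refl)
    unit-forms (u₁ , + suc m) e = inj₂ (inj₂ (off-axis-unit u₁ m e))
    unit-forms (u₁ , -[1+ m ]) e = inj₂ (inj₂ (off-axis-unit u₁ m e))

    -- Multiplying a generator by a unit does not change the ideal:
    -- (q · conj u) · (u γ) = N(u) · q γ = q γ.
    unit-associate : ∀ u γ → norm u ≡ 1 → SameIdeal ⟨ γ ⟩ ⟨ u *R γ ⟩
    unit-associate u γ normu x = into , (λ { (q , refl) → q *R u , *R-assoc q u γ })
      where
      normℤu : normℤ u ≡ + 1
      normℤu = trans (sym (norm-normℤ u)) (cong +_ normu)
      into : Mem ⟨ γ ⟩ x → Mem ⟨ u *R γ ⟩ x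
      into (q , refl) = q *R conj u , (begin
        (q *R conj u) *R (u *R γ)  ≡⟨ *R-assoc (q *R conj u) u γ ⟨
        ((q *R conj u) *R u) *R γ  ≡⟨ cong (_*R γ) (conj-cancelʳ q u) ⟩
        (normℤ u · q) *R γ         ≡⟨ ·-*R (normℤ u) q γ ⟩
        normℤ u · (q *R γ)         ≡⟨ cong (_· (q *R γ)) normℤu ⟩
        + 1 · (q *R γ)             ≡⟨ cong₂ _,_ (ℤP.*-identityˡ _) (ℤP.*-identityˡ _) ⟩
        q *R γ                     ∎)
        where open ≡-Reasoning

    sign-normalise : ∀ a b → Σ ℤ[√- d ] λ u → norm u ≡ 1 × Σ ℤ λ b' → u *R (a , b) ≡ (+ ∣ a ∣ , b') × ∣ b' ∣ ≡ ∣ b ∣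
    sign-normalise (+ m) b = (+ 1 , + 0) , cong suc (ℕP.*-zeroʳ d) , b , *R-identityˡ (+ m , b) , refl
    sign-normalise -[1+ m ] b = (- + 1 , + 0) , cong suc (ℕP.*-zeroʳ d) , - b ,
      trans (scalar-*R (- + 1) (-[1+ m ] , b)) (cong₂ _,_ (ℤP.-1*i≡-i -[1+ m ]) (ℤP.-1*i≡-i b)) , ℤP.∣-i∣≡∣i∣ b

  -- The ideals of norm n (odd) of ℤ[√-d], d ∈ {1, 2}, are enumerated by the
  -- generators (+x , ±k·y) with n = x² + c·y², where c = d·k².  Every γ of norm n
  -- is assumed to have a unit multiple of this form (checked separately for
  -- d = 1, 2); it is unique, since x is odd while d·k is even.
  module Enumeration (d c k' : ℕ) (1≤d : 1 ≤ d) (d≤2 : d ≤ 2) (1≤c : 1 ≤ c) (c-even : c % 2 ≡ 0)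
      (c≡dk² : ∀ y → d ℕ.* ((suc k' ℕ.* y) ℕ.* (suc k' ℕ.* y)) ≡ c ℕ.* (y ℕ.* y))
      (dk-even : Σ ℕ λ w → d ℕ.* suc k' ≡ 2 ℕ.* w)
      (n' : ℕ) (n-odd : suc n' % 2 ≡ 1)
      (normal-form : ∀ γ → Arithmetic.norm d γ ≡ suc n' →
         Σ (ℤ × ℤ) λ u → Arithmetic.norm d u ≡ 1 × Counting.Generator c k' (suc n') 1≤c (Ring._*R_ d u γ)) where
    open Arithmetic d
    open Units d 1≤d
    open Euclidean d 1≤d d≤2 using (principal)
    open Counting c k' (suc n') 1≤c

    n : ℕ
    n = suc n'

    generator-norm : ∀ {v} → Generator v → norm v ≡ n
    generator-norm (x , y , b , refl , e , |b|) =
      trans (cong (λ z → x ℕ.* x ℕ.+ d ℕ.* (z ℕ.* z)) |b|) (trans (cong (x ℕ.* x ℕ.+_) (c≡dk² y)) e)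

    negative≢ : ∀ x x' → x % 2 ≡ 1 → - + x ≢ + x'
    negative≢ zero _ () _
    negative≢ (suc m) _ _ ()

    √-d-multiple : ∀ u₂ x b → proj₁ ((+ 0 , u₂) *R (+ x , b)) ≡ - (+ d * (u₂ * b))
    √-d-multiple u₂ x b = first (+ d) u₂ (+ x) b
      where
      first : ∀ D u₂ x b → + 0 * x - D * (u₂ * b) ≡ - (D * (u₂ * b))
      first = solve-∀

    -- Two generators that are unit multiples of each other are equal: the unit
    -- cannot be -1 (first coordinates are ≥ 0 and odd) nor ±√-d (it would make
    -- the odd first coordinate a multiple of d·k, which is even).
    associates-equal : ∀ {α β} u → Generator α → Generator β → norm u ≡ 1 → u *R β ≡ α → α ≡ β
    associates-equal (u₁ , u₂) (xa , ya , ba , refl , ea , |ba|) (xb , yb , bb , refl , eb , |bb|) normu uβ≡α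
      with unit-forms (u₁ , u₂) normu
    ... | inj₁ refl = trans (sym uβ≡α) (*R-identityˡ _)
    ... | inj₂ (inj₁ refl) = ⊥-elim (negative≢ xb xa (odd-square-part xb yb c n eb n-odd c-even)
            (trans (sym (cong proj₁ negation)) (cong proj₁ uβ≡α)))
      where
      negation : (- + 1 , + 0) *R (+ xb , bb) ≡ (- + xb , - bb)
      negation = trans (scalar-*R (- + 1) (+ xb , bb)) (cong₂ _,_ (ℤP.-1*i≡-i _) (ℤP.-1*i≡-i _))
    ... | inj₂ (inj₂ (refl , |u₂|)) =
            ⊥-elim (odd≢double xa (w ℕ.* yb) (odd-square-part xa ya c n ea n-odd c-even) xa-even)
      where
      w = proj₁ dk-even
      reassociate : ∀ d k y → d ℕ.* (1 ℕ.* (k ℕ.* y)) ≡ (d ℕ.* k) ℕ.* y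
      reassociate = ℕSolver.solve-∀
      xa-even : xa ≡ 2 ℕ.* (w ℕ.* yb)
      xa-even = begin
        xa                              ≡⟨ cong ∣_∣ (trans (sym (cong proj₁ uβ≡α)) (√-d-multiple u₂ xb bb)) ⟩
        ∣ - (+ d * (u₂ * bb)) ∣         ≡⟨ ℤP.∣-i∣≡∣i∣ (+ d * (u₂ * bb)) ⟩
        ∣ + d * (u₂ * bb) ∣             ≡⟨ ℤP.abs-* (+ d) (u₂ * bb) ⟩
        d ℕ.* ∣ u₂ * bb ∣               ≡⟨ cong (d ℕ.*_) (ℤP.abs-* u₂ bb) ⟩
        d ℕ.* (∣ u₂ ∣ ℕ.* ∣ bb ∣)       ≡⟨ cong₂ (λ p q → d ℕ.* (p ℕ.* q)) |u₂| |bb| ⟩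
        d ℕ.* (1 ℕ.* (suc k' ℕ.* yb))   ≡⟨ reassociate d (suc k') yb ⟩
        (d ℕ.* suc k') ℕ.* yb           ≡⟨ cong (ℕ._* yb) (proj₂ dk-even) ⟩
        (2 ℕ.* w) ℕ.* yb                ≡⟨ ℕP.*-assoc 2 w yb ⟩
        2 ℕ.* (w ℕ.* yb)                ∎
        where open ≡-Reasoning

    -- Distinct generators generate distinct ideals: if ⟨α⟩ = ⟨β⟩ then α = uβ
    -- with N(u)·n = n, so u is a unit.
    same-ideal⇒equal : ∀ {α β} → Generator α → Generator β → SameIdeal ⟨ α ⟩ ⟨ β ⟩ → α ≡ β
    same-ideal⇒equal {α} {β} gα gβ α≈β with proj₁ (α≈β α) (generator∈ α)
    ... | u , uβ≡α = associates-equal u gα gβ normu uβ≡α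
      where
      open ≡-Reasoning
      normu : norm u ≡ 1
      normu = ℕP.*-cancelʳ-≡ (norm u) 1 n (begin
        norm u ℕ.* n         ≡⟨ cong (norm u ℕ.*_) (generator-norm gβ) ⟨
        norm u ℕ.* norm β    ≡⟨ norm-*R u β ⟨
        norm (u *R β)        ≡⟨ cong norm uβ≡α ⟩
        norm α               ≡⟨ generator-norm gα ⟩
        n                    ≡⟨ ℕP.*-identityˡ n ⟨
        1 ℕ.* n              ∎)

    ideals : NumIdealsOfNorm n (length generators)
    ideals = enumerate , has-norm , distinct , complete
      where
      enumerate : Fin (length generators) → Ideal
      enumerate i = ⟨ lookup generators i ⟩

      generator-at : ∀ i → Generator (lookup generators i)
      generator-at i = ∈generators (∈P.∈-lookup i)

      has-norm : ∀ i → HasNorm (enumerate i) n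
      has-norm i = (v , v≢0 , generator∈ v) , PrincipalIdeal.quotient-card-principal d v n' (generator-norm (generator-at i))
        where
        v = lookup generators i
        v≢0 : v ≢ 0R
        v≢0 v≡0 = ℕP.1+n≢0 (trans (sym (generator-norm (generator-at i))) (trans (cong norm v≡0) (ℕP.*-zeroʳ d)))

      distinct : ∀ i j → SameIdeal (enumerate i) (enumerate j) → i ≡ j
      distinct i j same = lookup-injective generators-unique i j (same-ideal⇒equal (generator-at i) (generator-at j) same)

      -- I = ⟨γ⟩ = ⟨uγ⟩ with uγ a generator.
      complete : ∀ I → HasNorm I n → Σ (Fin (length generators)) λ i → SameIdeal I (enumerate i)
      complete I has-norm-n = Any.index v∈ , I≈⟨v⟩
        where
        γ-data = principal I n has-norm-n
        γ = proj₁ γ-data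
        normal = normal-form γ (proj₂ (proj₂ γ-data))
        u = proj₁ normal
        v-data : Generator (u *R γ)
        v-data = proj₂ (proj₂ normal)
        v∈ = generators∋ (proj₁ v-data) (proj₁ (proj₂ v-data)) (proj₁ (proj₂ (proj₂ v-data)))
               (proj₁ (proj₂ (proj₂ (proj₂ (proj₂ v-data))))) (proj₂ (proj₂ (proj₂ (proj₂ (proj₂ v-data)))))
        uγ≡v : u *R γ ≡ lookup generators (Any.index v∈)
        uγ≡v = trans (proj₁ (proj₂ (proj₂ (proj₂ v-data)))) (AnyP.lookup-index v∈)
        I≈⟨v⟩ : SameIdeal I ⟨ lookup generators (Any.index v∈) ⟩
        I≈⟨v⟩ = same-trans {I} {⟨ γ ⟩} {⟨ lookup generators (Any.index v∈) ⟩} (proj₁ (proj₂ γ-data))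
                  (same-trans {⟨ γ ⟩} {⟨ u *R γ ⟩} {⟨ lookup generators (Any.index v∈) ⟩} (unit-associate u γ (proj₁ (proj₂ normal)))
                    (subst (λ v → SameIdeal ⟨ u *R γ ⟩ ⟨ v ⟩) uγ≡v (same-refl {⟨ u *R γ ⟩})))

  -- Normal forms for d = 2 (c = 2, k = 1): multiply by ±1.
  normal-form-√-2 : ∀ n γ → Arithmetic.norm 2 γ ≡ n →
    Σ (ℤ × ℤ) λ u → Arithmetic.norm 2 u ≡ 1 × Counting.Generator 2 0 n (s≤s z≤n) (Ring._*R_ 2 u γ)
  normal-form-√-2 n (a , b) normγ with Units.sign-normalise 2 (s≤s z≤n) a b
  ... | u , normu , b' , uγ≡ , |b'| = u , normu , ∣ a ∣ , ∣ b ∣ , b' , uγ≡ , normγ , trans |b'| (sym (ℕP.*-identityˡ _))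

  -- Normal forms for d = 1 (c = 4, k = 2): of a, b exactly one is odd; make it
  -- the first coordinate (multiplying by ±i if necessary) with a sign change.
  normal-form-i : ∀ n → n % 2 ≡ 1 → ∀ γ → Arithmetic.norm 1 γ ≡ n →
    Σ (ℤ × ℤ) λ u → Arithmetic.norm 1 u ≡ 1 × Counting.Generator 4 1 n (s≤s z≤n) (Ring._*R_ 1 u γ)
  normal-form-i n n-odd (a , b) normγ
    with odd-sum-of-squares ∣ a ∣ ∣ b ∣ n (trans (cong (∣ a ∣ ℕ.* ∣ a ∣ ℕ.+_) (sym (ℕP.*-identityˡ _))) normγ) n-odd
  ... | inj₁ (_ , b-even) with Units.sign-normalise 1 (s≤s z≤n) a b
  ...   | u , normu , b' , uγ≡ , |b'| = u , normu , ∣ a ∣ , ∣ b ∣ / 2 , b' , uγ≡ , representation , trans |b'| |b|≡2y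
    where
    |b|≡2y = even-half ∣ b ∣ b-even
    quadruple : ∀ y → 4 ℕ.* (y ℕ.* y) ≡ 1 ℕ.* ((2 ℕ.* y) ℕ.* (2 ℕ.* y))
    quadruple = ℕSolver.solve-∀
    representation : ∣ a ∣ ℕ.* ∣ a ∣ ℕ.+ 4 ℕ.* ((∣ b ∣ / 2) ℕ.* (∣ b ∣ / 2)) ≡ n
    representation = trans (cong (∣ a ∣ ℕ.* ∣ a ∣ ℕ.+_)
      (trans (quadruple (∣ b ∣ / 2)) (cong (λ z → 1 ℕ.* (z ℕ.* z)) (sym |b|≡2y)))) normγ
  normal-form-i n n-odd (a , b) normγ | inj₂ (a-even , _) = rotate b refl
    where
    |a|≡2y = even-half ∣ a ∣ a-even
    quadruple : ∀ y → 4 ℕ.* (y ℕ.* y) ≡ (2 ℕ.* y) ℕ.* (2 ℕ.* y)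
    quadruple = ℕSolver.solve-∀
    representation : ∣ b ∣ ℕ.* ∣ b ∣ ℕ.+ 4 ℕ.* ((∣ a ∣ / 2) ℕ.* (∣ a ∣ / 2)) ≡ n
    representation = trans (cong (∣ b ∣ ℕ.* ∣ b ∣ ℕ.+_) (trans (quadruple (∣ a ∣ / 2)) (cong (λ z → z ℕ.* z) (sym |a|≡2y))))
      (trans (ℕP.+-comm _ (∣ a ∣ ℕ.* ∣ a ∣)) (trans (cong (∣ a ∣ ℕ.* ∣ a ∣ ℕ.+_) (sym (ℕP.*-identityˡ _))) normγ))
    -i·-rotation : ∀ a b → Ring._*R_ 1 (+ 0 , - + 1) (a , b) ≡ (b , - a)
    -i·-rotation a b = cong₂ _,_ (re a b) (im a b)
      where
      re : ∀ a b → + 0 * a - + 1 * (- + 1 * b) ≡ b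
      re = solve-∀
      im : ∀ a b → + 0 * b + - + 1 * a ≡ - a
      im = solve-∀
    i·-rotation : ∀ a b → Ring._*R_ 1 (+ 0 , + 1) (a , b) ≡ (- b , a)
    i·-rotation a b = cong₂ _,_ (re a b) (im a b)
      where
      re : ∀ a b → + 0 * a - + 1 * (+ 1 * b) ≡ - b
      re = solve-∀
      im : ∀ a b → + 0 * b + + 1 * a ≡ a
      im = solve-∀
    rotate : ∀ b₀ → b₀ ≡ b → Σ (ℤ × ℤ) λ u → Arithmetic.norm 1 u ≡ 1 × Counting.Generator 4 1 n (s≤s z≤n) (Ring._*R_ 1 u (a , b))
    rotate (+ m) refl = (+ 0 , - + 1) , refl , m , ∣ a ∣ / 2 , - a , -i·-rotation a (+ m) , representation ,
                        trans (ℤP.∣-i∣≡∣i∣ a) |a|≡2y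
    rotate -[1+ m ] refl = (+ 0 , + 1) , refl , suc m , ∣ a ∣ / 2 , a , i·-rotation a -[1+ m ] , representation , |a|≡2y

  -- ℤ[√-2]: d = 2, c = 2·1², k = 1.
  module ℤ[√-2]-ideals (n' : ℕ) (n-odd : suc n' % 2 ≡ 1) =
    Enumeration 2 2 0 (s≤s z≤n) (s≤s (s≤s z≤n)) (s≤s z≤n) refl ℕSolver.solve-∀ (1 , refl) n' n-odd
      (normal-form-√-2 (suc n'))

  -- ℤ[i] = ℤ[√-1]: d = 1, c = 1·2², k = 2.
  module ℤ[i]-ideals (n' : ℕ) (n-odd : suc n' % 2 ≡ 1) =
    Enumeration 1 4 1 (s≤s z≤n) (s≤s z≤n) (s≤s z≤n) refl ℕSolver.solve-∀ (1 , refl) n' n-odd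
      (normal-form-i (suc n') n-odd)


open ImaginaryQuadratic using (module Counting; module ℤ[√-2]-ideals; module ℤ[i]-ideals)

open import Defs
open import Data.Nat using (ℕ; _*_; _∸_; _%_)
open import Data.Product using (_×_)
open import Relation.Nullary using (¬_)
open import Relation.Binary.PropositionalEquality using (_≡_)

open import Data.Nat using (zero; suc; s≤s; z≤n)
open import Data.Product using (_,_)
open import Relation.Binary.PropositionalEquality using (subst)

lemma3p3 : (n : ℕ) → n % 2 ≡ 1 →
    ((IsSquare n → Ring.NumIdealsOfNorm 2 n (2 * U₁ n ∸ 1)) ×
     (¬ IsSquare n → Ring.NumIdealsOfNorm 2 n (2 * U₁ n))) ×
    ((IsSquare n → Ring.NumIdealsOfNorm 1 n (2 * V₁ n ∸ 1)) ×
     (¬ IsSquare n → Ring.NumIdealsOfNorm 1 n (2 * V₁ n)))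
lemma3p3 zero ()
lemma3p3 n@(suc n') n-odd =
  ( (λ square → subst (Ring.NumIdealsOfNorm 2 n) (Counting.count-square 2 0 n (s≤s z≤n) square) √-2.ideals)
  , (λ nonsquare → subst (Ring.NumIdealsOfNorm 2 n) (Counting.count-nonsquare 2 0 n (s≤s z≤n) nonsquare) √-2.ideals) )
  , ( (λ square → subst (Ring.NumIdealsOfNorm 1 n) (Counting.count-square 4 1 n (s≤s z≤n) square) i.ideals)
  , (λ nonsquare → subst (Ring.NumIdealsOfNorm 1 n) (Counting.count-nonsquare 4 1 n (s≤s z≤n) nonsquare) i.ideals) )
  where
  module √-2 = ℤ[√-2]-ideals n' n-odd
  module i = ℤ[i]-ideals n' n-odd
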